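{- Let $G$ be a finite group whose order is not a prime power, and let $m$ be the exponent of $G$. Then the set of dominant vertices of the order superpower graph of $G$ consists of the identity together with the elements of order $m$ (if there are any).
   Context: A dominant vertex is one joined to all other vertices. The order superpower graph of $G$ has vertex set $G$, with distinct $g,h$ adjacent iff there exist $g',h'\in G$ with $o(g')=o(g)$, $o(h')=o(h)$ such that $g'=h'$ or one of $g',h'$ is a power of the other; equivalently, iff $o(g)\mid o(h)$ or $o(h)\mid o(g)$. -}

module Defs where

open import Level using (0ℓ)
open import Data.Nat using (ℕ; zero; suc; _<_; _^_)
open import Data.Nat.Primality using (Prime)
open import Data.Fin using (Fin)
open import Data.Product using (Σ; ∃; _×_)
open import Data.Sum using (_⊎_)
open import Relation.Nullary using (¬_)
open import Relation.Binary.PropositionalEquality using (_≡_; _≢_)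
open import Algebra.Structures using (IsGroup)
open import Function.Bundles using (_⇔_)

-- A finite group of order n, presented (up to isomorphism) with carrier Fin n
-- and propositional equality.
record FinGroup (n : ℕ) : Set where
  field
    _∙_   : Fin n → Fin n → Fin n
    e     : Fin n
    inv   : Fin n → Fin n
    isGroup : IsGroup _≡_ _∙_ e inv

module _ {n : ℕ} (G : FinGroup n) where
  open FinGroup G

  pow : Fin n → ℕ → Fin n
  pow g zero    = e
  pow g (suc k) = g ∙ pow g k

  HasOrder : Fin n → ℕ → Set
  HasOrder g d = (0 < d) × (pow g d ≡ e) × (∀ k → 0 < k → k < d → pow g k ≢ e)

  SameOrder : Fin n → Fin n → Set
  SameOrder g g' = ∀ d → HasOrder g d ⇔ HasOrder g' d

  IsExponent : ℕ → Set
  IsExponent m = (0 < m) × (∀ g → pow g m ≡ e)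
                 × (∀ k → 0 < k → k < m → ¬ (∀ g → pow g k ≡ e))

  IsPowerOf : Fin n → Fin n → Set
  IsPowerOf x y = ∃ λ k → x ≡ pow y k

  -- adjacency in the order superpower graph (for distinct g, h)
  OSPAdj : Fin n → Fin n → Set
  OSPAdj g h = Σ (Fin n) λ g' → Σ (Fin n) λ h' →
    SameOrder g g' × SameOrder h h' ×
    (g' ≡ h' ⊎ IsPowerOf g' h' ⊎ IsPowerOf h' g')

  Dominant : Fin n → Set
  Dominant g = ∀ h → h ≢ g → OSPAdj g h

IsPrimePower : ℕ → Set
IsPrimePower n = ∃ λ p → ∃ λ k → Prime p × n ≡ p ^ k

-- If g ≠ e is dominant, the order d of g is comparable under divisibility
-- with the order of every element. By Cauchy's theorem (McKay's proof) there
-- are elements of order p and q for two distinct primes p, q dividing |G|, so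
-- p ∣ d and q ∣ d. If some element had order D with d ∣ D but D ∤ d, pick a
-- prime r ∣ D/d and a prime s ∈ {p, q} different from r: a power of that
-- element has order r·d/s, which is incomparable with d. Hence every order
-- divides d, and d is the exponent. Conversely, when o(g) is the exponent,
-- every o(h) divides o(g), and o(h) is the order of a power of g.
module Submission where

open import Defs
open import Data.Nat using (ℕ)
open import Data.Fin using (Fin)
open import Data.Sum using (_⊎_)
open import Relation.Nullary using (¬_)
open import Relation.Binary.PropositionalEquality using (_≡_)
open import Function.Bundles using (_⇔_)

open import Level using (0ℓ)
open import Algebra.Bundles using (Group)
open import Algebra.Structures using (IsGroup)
import Algebra.Properties.Group as GroupProperties
open import Data.Empty using (⊥-elim)
import Data.Fin as Fin
open import Data.Fin.Properties using (nonZeroIndex)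
open import Data.List
  using (List; []; _∷_; _++_; [_]; _∷ʳ_; length; map; filter; foldr; replicate; applyUpTo;
         cartesianProductWith; allFin; initLast; _∷ʳ′_)
open import Data.List.Properties
  using (length-++; length-map; length-applyUpTo; length-replicate; length-tabulate;
         ++-assoc; ++-identityʳ; ∷-injective; ∷ʳ-injective; ≡-dec)
open import Data.List.Membership.Propositional using (_∈_; find)
open import Data.List.Membership.Propositional.Properties
  using (∈-filter⁺; ∈-filter⁻; ∈-map⁺; ∈-map⁻; ∈-applyUpTo⁺; ∈-applyUpTo⁻;
         ∈-cartesianProductWith⁺; ∈-cartesianProductWith⁻; ∈-allFin)
open import Data.List.Membership.Propositional.Properties.WithK using (unique∧set⇒bag)
open import Data.List.Relation.Binary.BagAndSetEquality using (∼bag⇒↭)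
open import Data.List.Relation.Binary.Permutation.Propositional.Properties using (↭-length)
open import Data.List.Relation.Unary.All as All using (All; []; _∷_)
open import Data.List.Relation.Unary.All.Properties using (¬All⇒Any¬)
open import Data.List.Relation.Unary.AllPairs using ([]; _∷_)
open import Data.List.Relation.Unary.Any using (here; there)
open import Data.List.Relation.Unary.Unique.Propositional using (Unique)
open import Data.List.Relation.Unary.Unique.Propositional.Properties
  using (filter⁺; map⁺; applyUpTo⁺₁; cartesianProductWith⁺; allFin⁺)
open import Data.Nat as ℕ
  using (zero; suc; _+_; _*_; _∸_; _≤_; _<_; z≤n; s≤s; NonZero; _%_; _/_)
open import Data.Nat.Properties
open import Data.Nat.Coprimality using (prime⇒coprime; coprime-Bézout)
open import Data.Nat.Divisibility
open import Data.Nat.DivMod using (m≡m%n+[m/n]*n; m%n<n)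
open import Data.Nat.GCD using (module Bézout)
open import Data.Nat.Induction using (<-wellFounded)
open import Data.Nat.ListAction using (product)
open import Data.Nat.ListAction.Properties using (∈⇒∣product)
open import Data.Nat.Primality
open import Data.Nat.Primality.Factorisation using (factorise)
open import Data.Product using (∃; ∃₂; _×_; _,_; proj₁; proj₂)
open import Data.Sum using (inj₁; inj₂; [_,_]′)
open import Function.Base using (id; _∘_; _$_; flip)
open import Function.Bundles using (mk⇔; Equivalence)
open import Induction.WellFounded using (Acc; acc)
open import Relation.Binary.Definitions using (DecidableEquality)
open import Relation.Binary.PropositionalEquality
  using (_≢_; refl; sym; trans; cong; cong₂; cong-app; subst; module ≡-Reasoning)
open import Relation.Nullary using (yes; no; contradiction; _×-dec_)
open import Relation.Unary using (Decidable)
open import Relation.Unary.Properties using (∁?)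

module _ {P : ℕ → Set} (P? : Decidable P) where

  Least : Set
  Least = ∃ λ d → P d × (∀ {k} → k < d → ¬ P k)

  leastBelow : ∀ m {j} → j ≤ m → P j → Least
  leastBelow zero z≤n Pj = 0 , Pj , λ ()
  leastBelow (suc m) {j} j≤1+m Pj with anyUpTo? P? (suc m)
  ... | yes (k , k<1+m , Pk) = leastBelow m (ℕ.s≤s⁻¹ k<1+m) Pk
  ... | no none = j , Pj , λ k<j Pk → none (_ , <-≤-trans k<j j≤1+m , Pk)

  least : ∀ {j} → P j → Least
  least {j} = leastBelow j ≤-refl

module _ {A : Set} where

  length-filter-∁ : ∀ {P : A → Set} (P? : Decidable P) xs →
                    length (filter P? xs) + length (filter (∁? P?) xs) ≡ length xs
  length-filter-∁ P? [] = refl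
  length-filter-∁ P? (x ∷ xs) with P? x
  ... | yes _ = cong suc (length-filter-∁ P? xs)
  ... | no _ = trans (+-suc _ _) (cong suc (length-filter-∁ P? xs))

  length-∷ʳ : ∀ (xs : List A) x → length (xs ∷ʳ x) ≡ suc (length xs)
  length-∷ʳ xs x = trans (length-++ xs) (+-comm (length xs) 1)

  length-cartesianProductWith : ∀ {B C : Set} (f : A → B → C) xs ys →
    length (cartesianProductWith f xs ys) ≡ length xs * length ys
  length-cartesianProductWith f [] ys = refl
  length-cartesianProductWith f (x ∷ xs) ys = trans (length-++ (map (f x) ys))
    (cong₂ _+_ (length-map (f x) ys) (length-cartesianProductWith f xs ys))

  replicate-∷ʳ : ∀ k (x : A) → replicate k x ∷ʳ x ≡ x ∷ replicate k x
  replicate-∷ʳ zero x = refl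
  replicate-∷ʳ (suc k) x = cong (x ∷_) (replicate-∷ʳ k x)

  ∷ʳ≡∷⇒replicate : ∀ (x : A) xs → xs ∷ʳ x ≡ x ∷ xs → xs ≡ replicate (length xs) x
  ∷ʳ≡∷⇒replicate x [] _ = refl
  ∷ʳ≡∷⇒replicate x (y ∷ xs) yxs∷ʳx≡xyxs with refl , xs∷ʳx≡xxs ← ∷-injective yxs∷ʳx≡xyxs
    = cong (x ∷_) (∷ʳ≡∷⇒replicate x xs xs∷ʳx≡xxs)

  ∈⇒length-nonZero : ∀ {x : A} {xs} → x ∈ xs → NonZero (length xs)
  ∈⇒length-nonZero (here _) = _
  ∈⇒length-nonZero (there _) = _

  ∃-≢-in-unique : DecidableEquality A → ∀ {xs : List A} → Unique xs → 2 ≤ length xs →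
                  ∀ y → ∃ λ x → x ∈ xs × x ≢ y
  ∃-≢-in-unique _ {_ ∷ []} _ (s≤s ())
  ∃-≢-in-unique _≟ᴬ_ {a ∷ b ∷ _} ((a≢b ∷ _) ∷ _) _ y with a ≟ᴬ y
  ... | no a≢y = a , here refl , a≢y
  ... | yes refl = b , there (here refl) , a≢b ∘ sym

module Iteration {A : Set} (σ : A → A) where
  open import Function.Endo.Propositional A using (_^_; ^-homo)

  ^-+ : ∀ a b x → (σ ^ (a + b)) x ≡ (σ ^ a) ((σ ^ b) x)
  ^-+ a b = cong-app (^-homo σ a b)

  ^-suc′ : ∀ k x → (σ ^ suc k) x ≡ (σ ^ k) (σ x)
  ^-suc′ k x = trans (cong (λ j → (σ ^ j) x) (+-comm 1 k)) (^-+ k 1 x)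

  ^-periodic : ∀ {p x} c → (σ ^ p) x ≡ x → (σ ^ (c * p)) x ≡ x
  ^-periodic zero _ = refl
  ^-periodic {p} {x} (suc c) σᵖx≡x = begin
    (σ ^ (p + c * p)) x      ≡⟨ ^-+ p (c * p) x ⟩
    (σ ^ p) ((σ ^ (c * p)) x) ≡⟨ cong (σ ^ p) (^-periodic c σᵖx≡x) ⟩
    (σ ^ p) x                ≡⟨ σᵖx≡x ⟩
    x                        ∎
    where open ≡-Reasoning

  ^-mod : ∀ {q x} .{{_ : NonZero q}} k → (σ ^ q) x ≡ x → (σ ^ k) x ≡ (σ ^ (k % q)) x
  ^-mod {q} {x} k σᵠx≡x = begin
    (σ ^ k) x                                   ≡⟨ cong (λ j → (σ ^ j) x) (m≡m%n+[m/n]*n k q) ⟩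
    (σ ^ (k % q + (k / q) * q)) x               ≡⟨ ^-+ (k % q) _ x ⟩
    (σ ^ (k % q)) ((σ ^ ((k / q) * q)) x)       ≡⟨ cong (σ ^ (k % q)) (^-periodic (k / q) σᵠx≡x) ⟩
    (σ ^ (k % q)) x                             ∎
    where open ≡-Reasoning

  -- Bézout: 1 is an integer combination of the periods k and q.
  fixed-by-prime-period : ∀ {q k x} → Prime q → (σ ^ q) x ≡ x →
                          0 < k → k < q → (σ ^ k) x ≡ x → σ x ≡ x
  fixed-by-prime-period {q} {k@(suc _)} {x} q-prime σᵠx≡x _ k<q σᵏx≡x
    with coprime-Bézout (prime⇒coprime q-prime k<q)
  ... | Bézout.+- a b 1+bk≡aq = begin
    σ x                  ≡⟨ cong σ (^-periodic b σᵏx≡x) ⟨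
    (σ ^ suc (b * k)) x  ≡⟨ cong (λ j → (σ ^ j) x) 1+bk≡aq ⟩
    (σ ^ (a * q)) x      ≡⟨ ^-periodic a σᵠx≡x ⟩
    x                    ∎
    where open ≡-Reasoning
  ... | Bézout.-+ a b 1+aq≡bk = begin
    σ x                  ≡⟨ cong σ (^-periodic a σᵠx≡x) ⟨
    (σ ^ suc (a * q)) x  ≡⟨ cong (λ j → (σ ^ j) x) 1+aq≡bk ⟩
    (σ ^ (b * k)) x      ≡⟨ ^-periodic b σᵏx≡x ⟩
    x                    ∎
    where open ≡-Reasoning

-- Maps of prime period on a finite set

module PrimePeriod {A : Set} (_≟ᴬ_ : DecidableEquality A) (σ : A → A)
                   {q : ℕ} (q-prime : Prime q) where
  open import Function.Endo.Propositional A using (_^_)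
  open import Data.List.Membership.DecPropositional _≟ᴬ_ using (_∈?_)
  open Iteration σ

  instance
    q-nonZero : NonZero q
    q-nonZero = prime⇒nonZero q-prime

  Closed Periodic FixedPointFree : List A → Set
  Closed L = ∀ {x} → x ∈ L → σ x ∈ L
  Periodic L = ∀ {x} → x ∈ L → (σ ^ q) x ≡ x
  FixedPointFree L = ∀ {x} → x ∈ L → σ x ≢ x

  ^-unfold : ∀ y → (σ ^ q) y ≡ (σ ^ ℕ.pred q) (σ y)
  ^-unfold y = trans (cong (λ t → (σ ^ t) y) (sym (suc-pred q))) (^-suc′ (ℕ.pred q) y)

  orbit : A → List A
  orbit x = applyUpTo (λ i → (σ ^ i) x) q

  ^-∈-orbit : ∀ {x} k → (σ ^ q) x ≡ x → (σ ^ k) x ∈ orbit x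
  ^-∈-orbit {x} k σᵠx≡x = subst (_∈ orbit x) (sym (^-mod k σᵠx≡x))
    (∈-applyUpTo⁺ (λ i → (σ ^ i) x) (m%n<n k q))

  ^-∈ : ∀ {L} → Closed L → ∀ k {x} → x ∈ L → (σ ^ k) x ∈ L
  ^-∈ closed zero x∈L = x∈L
  ^-∈ closed (suc k) x∈L = closed (^-∈ closed k x∈L)

  module _ {L : List A} (L-unique : Unique L) (closed : Closed L)
           (periodic : Periodic L) (free : FixedPointFree L) where

    orbit-unique : ∀ {x} → x ∈ L → Unique (orbit x)
    orbit-unique {x} x∈L = applyUpTo⁺₁ _ q λ {i} {j} i<j j<q σⁱx≡σʲx →
      let y∈L = ^-∈ closed i x∈L in
      free y∈L (fixed-by-prime-period q-prime (periodic y∈L) (m<n⇒0<n∸m i<j)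
        (≤-<-trans (m∸n≤m j i) j<q)
        (trans (sym (^-+ (j ∸ i) i x))
          (trans (cong (λ t → (σ ^ t) x) (m∸n+n≡m (<⇒≤ i<j))) (sym σⁱx≡σʲx))))

    length-filter-orbit : ∀ {x} → x ∈ L → length (filter (_∈? orbit x) L) ≡ q
    length-filter-orbit {x} x∈L = trans
      (↭-length (∼bag⇒↭ (unique∧set⇒bag (filter⁺ (_∈? orbit x) L-unique) (orbit-unique x∈L)
        (mk⇔ (proj₂ ∘ ∈-filter⁻ (_∈? orbit x) {xs = L}) ∈-filter-orbit))))
      (length-applyUpTo _ q)
      where
      ∈-filter-orbit : ∀ {z} → z ∈ orbit x → z ∈ filter (_∈? orbit x) L
      ∈-filter-orbit z∈ with ∈-applyUpTo⁻ _ z∈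
      ... | i , _ , refl = ∈-filter⁺ (_∈? orbit x) (^-∈ closed i x∈L) z∈

  -- The orbit of x has exactly q elements; remove it and recurse.
  prime∣length-free : ∀ L → Acc _<_ (length L) → Unique L →
                      Closed L → Periodic L → FixedPointFree L → q ∣ length L
  prime∣length-free [] _ _ _ _ _ = q ∣0
  prime∣length-free L@(x ∷ _) (acc rec) L-unique closed periodic free =
    subst (q ∣_) length-split (∣m∣n⇒∣m+n ∣-refl (prime∣length-free rest (rec rest<L)
      (filter⁺ outside? L-unique) rest-closed (periodic ∘ ∈-rest) (free ∘ ∈-rest)))
    where
    outside? : Decidable (λ y → ¬ y ∈ orbit x)
    outside? = ∁? (_∈? orbit x)
    rest : List A
    rest = filter outside? L
    ∈-rest : ∀ {y} → y ∈ rest → y ∈ L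
    ∈-rest = proj₁ ∘ ∈-filter⁻ outside? {xs = L}
    length-split : q + length rest ≡ length L
    length-split = trans (cong (_+ length rest)
      (sym (length-filter-orbit L-unique closed periodic free (here refl))))
      (length-filter-∁ (_∈? orbit x) L)
    rest<L : length rest < length L
    rest<L = subst (length rest <_) length-split
      (m<n+m (length rest) (ℕ.>-nonZero⁻¹ q))
    rest-closed : Closed rest
    rest-closed {y} y∈ with ∈-filter⁻ outside? {xs = L} y∈
    ... | y∈L , y∉orbit = ∈-filter⁺ outside? (closed y∈L) λ σy∈orbit →
      y∉orbit (back-in-orbit σy∈orbit)
      where
      back-in-orbit : σ y ∈ orbit x → y ∈ orbit x
      back-in-orbit σy∈orbit with ∈-applyUpTo⁻ _ σy∈orbit
      ... | i , _ , σy≡σⁱx = subst (_∈ orbit x) (sym y≡) (^-∈-orbit (ℕ.pred q + i) (periodic (here refl)))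
        where
        open ≡-Reasoning
        y≡ : y ≡ (σ ^ (ℕ.pred q + i)) x
        y≡ = begin
          y                             ≡⟨ periodic y∈L ⟨
          (σ ^ q) y                     ≡⟨ ^-unfold y ⟩
          (σ ^ ℕ.pred q) (σ y)          ≡⟨ cong (σ ^ ℕ.pred q) σy≡σⁱx ⟩
          (σ ^ ℕ.pred q) ((σ ^ i) x)    ≡⟨ ^-+ (ℕ.pred q) i x ⟨
          (σ ^ (ℕ.pred q + i)) x        ∎

  fixed? : Decidable (λ x → σ x ≡ x)
  fixed? x = σ x ≟ᴬ x

  prime∣length-fixed : ∀ {L} → Unique L → Closed L → Periodic L →
                       q ∣ length L → q ∣ length (filter fixed? L)
  prime∣length-fixed {L} L-unique closed periodic q∣L =
    ∣m+n∣m⇒∣n (subst (q ∣_) (trans (sym (length-filter-∁ fixed? L)) (+-comm (length (filter fixed? L)) _)) q∣L)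
      (prime∣length-free moving (<-wellFounded _) (filter⁺ (∁? fixed?) L-unique)
        moving-closed (periodic ∘ ∈-moving) (proj₂ ∘ ∈-filter⁻ (∁? fixed?) {xs = L}))
    where
    moving : List A
    moving = filter (∁? fixed?) L
    ∈-moving : ∀ {x} → x ∈ moving → x ∈ L
    ∈-moving = proj₁ ∘ ∈-filter⁻ (∁? fixed?) {xs = L}
    moving-closed : Closed moving
    moving-closed {x} x∈ with ∈-filter⁻ (∁? fixed?) {xs = L} x∈
    ... | x∈L , σx≢x = ∈-filter⁺ (∁? fixed?) (closed x∈L) λ σσx≡σx → σx≢x (begin
      σ x                      ≡⟨ periodic (closed x∈L) ⟨
      (σ ^ q) (σ x)            ≡⟨ ^-unfold (σ x) ⟩
      (σ ^ ℕ.pred q) (σ (σ x)) ≡⟨ cong (σ ^ ℕ.pred q) σσx≡σx ⟩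
      (σ ^ ℕ.pred q) (σ x)     ≡⟨ ^-unfold x ⟨
      (σ ^ q) x                ≡⟨ periodic x∈L ⟩
      x                        ∎)
      where open ≡-Reasoning

-- Powers and orders in a finite group

module GroupTheory {n : ℕ} (G : FinGroup n) where
  open FinGroup G
  open IsGroup isGroup using (assoc; identityˡ; identityʳ)
  open ≡-Reasoning
  open import Function.Endo.Propositional (Fin n) using () renaming (_^_ to _^ⁱ_)

  private
    infix 25 _^_
    _^_ : Fin n → ℕ → Fin n
    _^_ = pow G

  pow-+ : ∀ g a b → g ^ (a + b) ≡ g ^ a ∙ g ^ b
  pow-+ g zero b = sym (identityˡ _)
  pow-+ g (suc a) b = trans (cong (g ∙_) (pow-+ g a b)) (sym (assoc _ _ _))

  pow-* : ∀ g a b → (g ^ a) ^ b ≡ g ^ (b * a)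
  pow-* g a zero = refl
  pow-* g a (suc b) = trans (cong (g ^ a ∙_) (pow-* g a b)) (sym (pow-+ g a (b * a)))

  pow-e : ∀ k → e ^ k ≡ e
  pow-e zero = refl
  pow-e (suc k) = trans (cong (e ∙_) (pow-e k)) (identityˡ e)

  pow-*-e : ∀ g a b → g ^ a ≡ e → g ^ (b * a) ≡ e
  pow-*-e g a b gᵃ≡e = begin
    g ^ (b * a)   ≡⟨ pow-* g a b ⟨
    (g ^ a) ^ b   ≡⟨ cong (_^ b) gᵃ≡e ⟩
    e ^ b         ≡⟨ pow-e b ⟩
    e             ∎

  order-exists : ∀ {m} → IsExponent G m → ∀ g → ∃ (HasOrder G g)
  order-exists (0<m , gᵐ≡e , _) g
    with d , (0<d , gᵈ≡e) , below ← least (λ k → 0 <? k ×-dec (g ^ k Fin.≟ e)) (0<m , gᵐ≡e g)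
    = d , 0<d , gᵈ≡e , λ k 0<k k<d gᵏ≡e → below k<d (0<k , gᵏ≡e)

  order-∣ : ∀ {g d k} → HasOrder G g d → g ^ k ≡ e → d ∣ k
  order-∣ {g} {d@(suc _)} {k} (_ , gᵈ≡e , minimal) gᵏ≡e with k % d in k%d≡r
  ... | zero = m%n≡0⇒n∣m k d k%d≡r
  ... | suc r = ⊥-elim $ minimal (suc r) (s≤s z≤n) (subst (_< d) k%d≡r (m%n<n k d)) (begin
    g ^ suc r                       ≡⟨ identityʳ _ ⟨
    g ^ suc r ∙ e                   ≡⟨ cong (g ^ suc r ∙_) (pow-*-e g d (k / d) gᵈ≡e) ⟨
    g ^ suc r ∙ g ^ ((k / d) * d)   ≡⟨ pow-+ g (suc r) _ ⟨
    g ^ (suc r + (k / d) * d)       ≡⟨ cong (λ t → g ^ (t + (k / d) * d)) k%d≡r ⟨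
    g ^ (k % d + (k / d) * d)       ≡⟨ cong (g ^_) (m≡m%n+[m/n]*n k d) ⟨
    g ^ k                           ≡⟨ gᵏ≡e ⟩
    e                               ∎)

  ∣-order : ∀ {g d k} → HasOrder G g d → d ∣ k → g ^ k ≡ e
  ∣-order {g} {d} (_ , gᵈ≡e , _) (divides c refl) = pow-*-e g d c gᵈ≡e

  order-unique : ∀ {g d d′} → HasOrder G g d → HasOrder G g d′ → d ≡ d′
  order-unique hd hd′ = ∣-antisym (order-∣ hd (proj₁ (proj₂ hd′))) (order-∣ hd′ (proj₁ (proj₂ hd)))

  pow-as-iterate : ∀ x k → x ^ k ≡ ((x ∙_) ^ⁱ k) e
  pow-as-iterate x zero = refl
  pow-as-iterate x (suc k) = cong (x ∙_) (pow-as-iterate x k)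

  prime-order : ∀ {x q} → Prime q → x ^ q ≡ e → x ≢ e → HasOrder G x q
  prime-order {x} {q} q-prime xᵠ≡e x≢e =
    ℕ.>-nonZero⁻¹ q {{prime⇒nonZero q-prime}} , xᵠ≡e , λ k 0<k k<q xᵏ≡e →
      x≢e (trans (sym (identityʳ x)) (Iteration.fixed-by-prime-period (x ∙_) q-prime
        (trans (sym (pow-as-iterate x q)) xᵠ≡e) 0<k k<q (trans (sym (pow-as-iterate x k)) xᵏ≡e)))

  sameOrder : ∀ {x y d} → HasOrder G x d → HasOrder G y d → SameOrder G x y
  sameOrder hx hy d′ = mk⇔
    (λ hx′ → subst (HasOrder G _) (order-unique hx hx′) hy)
    (λ hy′ → subst (HasOrder G _) (order-unique hy hy′) hx)

  sameOrder-refl : ∀ x → SameOrder G x x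
  sameOrder-refl x d = mk⇔ id id

  order-of-power : ∀ {g D} a b → HasOrder G g D → D ≡ a * b → HasOrder G (g ^ a) b
  order-of-power {g} {D} a b hD@(0<D , gᴰ≡e , _) D≡ab =
    ℕ.>-nonZero⁻¹ b {{m*n≢0⇒n≢0 a}} , gᵃᵇ≡e , minimal
    where
    instance _ = ℕ.>-nonZero (subst (0 <_) D≡ab 0<D)
    gᵃᵇ≡e : (g ^ a) ^ b ≡ e
    gᵃᵇ≡e = trans (pow-* g a b) (trans (cong (g ^_) (trans (*-comm b a) (sym D≡ab))) gᴰ≡e)
    minimal : ∀ k → 0 < k → k < b → (g ^ a) ^ k ≢ e
    minimal k 0<k k<b gᵃᵏ≡e = <⇒≱ k<b (∣⇒≤ {{ℕ.>-nonZero 0<k}} (*-cancelˡ-∣ a {{m*n≢0⇒m≢0 a}}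
      (subst (_∣ a * k) D≡ab (order-∣ hD (trans (cong (g ^_) (*-comm a k)) (trans (sym (pow-* g a k)) gᵃᵏ≡e))))))

-- Cauchy's theorem, by McKay's counting argument

module Cauchy {n : ℕ} (G : FinGroup n) where
  open FinGroup G
  open IsGroup isGroup using (assoc; identityˡ; identityʳ; inverseˡ; inverseʳ)
  open GroupTheory G

  group : Group 0ℓ 0ℓ
  group = record { isGroup = isGroup }

  open GroupProperties group using (inverseʳ-unique)

  Word : Set
  Word = List (Fin n)

  open import Function.Endo.Propositional Word using (_^_)

  evaluate : Word → Fin n
  evaluate = foldr _∙_ e

  evaluate-∷ʳ : ∀ w x → evaluate (w ∷ʳ x) ≡ evaluate w ∙ x
  evaluate-∷ʳ [] x = trans (identityʳ x) (sym (identityˡ x))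
  evaluate-∷ʳ (y ∷ w) x = trans (cong (y ∙_) (evaluate-∷ʳ w x)) (sym (assoc _ _ _))

  evaluate-replicate : ∀ k x → evaluate (replicate k x) ≡ pow G x k
  evaluate-replicate zero x = refl
  evaluate-replicate (suc k) x = cong (x ∙_) (evaluate-replicate k x)

  words : ℕ → List Word
  words zero = [ [] ]
  words (suc k) = cartesianProductWith _∷_ (allFin n) (words k)

  length-words : ∀ k → length (words k) ≡ n ℕ.^ k
  length-words zero = refl
  length-words (suc k) = trans (length-cartesianProductWith _∷_ (allFin n) (words k))
    (cong₂ _*_ (length-tabulate {n = n} id) (length-words k))

  words-unique : ∀ k → Unique (words k)
  words-unique zero = [] ∷ []
  words-unique (suc k) = cartesianProductWith⁺ _∷_ ∷-injective (allFin⁺ n) (words-unique k)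

  ∈-words⁺ : ∀ w → w ∈ words (length w)
  ∈-words⁺ [] = here refl
  ∈-words⁺ (x ∷ w) = ∈-cartesianProductWith⁺ _∷_ (∈-allFin x) (∈-words⁺ w)

  ∈-words⁻ : ∀ k {w} → w ∈ words k → length w ≡ k
  ∈-words⁻ zero (here refl) = refl
  ∈-words⁻ (suc k) w∈ with ∈-cartesianProductWith⁻ _∷_ (allFin n) (words k) w∈
  ... | _ , _ , _ , u∈ , refl = cong suc (∈-words⁻ k u∈)

  rotate : Word → Word
  rotate [] = []
  rotate (x ∷ w) = w ∷ʳ x

  length-rotate : ∀ w → length (rotate w) ≡ length w
  length-rotate [] = refl
  length-rotate (x ∷ w) = length-∷ʳ w x

  evaluate-rotate : ∀ w → evaluate w ≡ e → evaluate (rotate w) ≡ e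
  evaluate-rotate [] w≡e = w≡e
  evaluate-rotate (x ∷ w) xw≡e = begin
    evaluate (w ∷ʳ x)  ≡⟨ evaluate-∷ʳ w x ⟩
    evaluate w ∙ x     ≡⟨ cong (_∙ x) (inverseʳ-unique x (evaluate w) xw≡e) ⟩
    inv x ∙ x          ≡⟨ inverseˡ x ⟩
    e                  ∎
    where open ≡-Reasoning

  rotate-^-length : ∀ u v → (rotate ^ length u) (u ++ v) ≡ v ++ u
  rotate-^-length [] v = sym (++-identityʳ v)
  rotate-^-length (x ∷ u) v = begin
    (rotate ^ suc (length u)) (x ∷ u ++ v)  ≡⟨ Iteration.^-suc′ rotate (length u) _ ⟩
    (rotate ^ length u) ((u ++ v) ∷ʳ x)    ≡⟨ cong (rotate ^ length u) (++-assoc u v [ x ]) ⟩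
    (rotate ^ length u) (u ++ v ∷ʳ x)      ≡⟨ rotate-^-length u (v ∷ʳ x) ⟩
    (v ∷ʳ x) ++ u                          ≡⟨ ++-assoc v [ x ] u ⟩
    v ++ x ∷ u                             ∎
    where open ≡-Reasoning

  rotate-^-length-id : ∀ (w : Word) → (rotate ^ length w) w ≡ w
  rotate-^-length-id w = subst (λ v → (rotate ^ length w) v ≡ w) (++-identityʳ w) (rotate-^-length w [])

  -- The q-words with product e correspond via close to all (q-1)-words, so q divides
  -- their number n^(q-1). Rotation permutes them with period q, hence q also divides the
  -- number of rotation-invariant ones, the words x…x with xᵠ = e; besides e…e there is another.
  module McKay (r : ℕ) (q-prime : Prime (suc r)) (q∣n : suc r ∣ n) where
    private q = suc r

    close : Word → Word
    close u = u ∷ʳ inv (evaluate u)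

    identityWords : List Word
    identityWords = map close (words r)

    ∈-identityWords⁻ : ∀ {w} → w ∈ identityWords → length w ≡ q × evaluate w ≡ e
    ∈-identityWords⁻ w∈ with ∈-map⁻ close w∈
    ... | u , u∈ , refl = trans (length-∷ʳ u _) (cong suc (∈-words⁻ r u∈)) ,
                          trans (evaluate-∷ʳ u _) (inverseʳ (evaluate u))

    ∈-identityWords⁺ : ∀ w → length w ≡ q → evaluate w ≡ e → w ∈ identityWords
    ∈-identityWords⁺ w |w|≡q w≡e with initLast w
    ∈-identityWords⁺ _ () _ | []
    ∈-identityWords⁺ _ |w|≡q w≡e | u ∷ʳ′ x =
      subst (λ y → u ∷ʳ y ∈ identityWords)
        (sym (inverseʳ-unique (evaluate u) x (trans (sym (evaluate-∷ʳ u x)) w≡e)))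
        (∈-map⁺ close (subst (λ k → u ∈ words k)
          (suc-injective (trans (sym (length-∷ʳ u x)) |w|≡q)) (∈-words⁺ u)))

    identityWords-unique : Unique identityWords
    identityWords-unique = map⁺ (λ {u} {u′} eq → proj₁ (∷ʳ-injective u u′ eq)) (words-unique r)

    prime∣length-identityWords : q ∣ length identityWords
    prime∣length-identityWords = subst (q ∣_) (sym (trans (length-map close (words r)) (length-words r)))
      (prime∣power r (ℕ.nonTrivial⇒n>1 q {{prime⇒nonTrivial q-prime}}))
      where
      prime∣power : ∀ k → 2 ≤ suc k → q ∣ n ℕ.^ k
      prime∣power zero (s≤s ())
      prime∣power (suc k) _ = ∣m⇒∣m*n (n ℕ.^ k) q∣n

    open PrimePeriod (≡-dec Fin._≟_) rotate q-prime

    identityWords-closed : Closed identityWords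
    identityWords-closed {w} w∈ with ∈-identityWords⁻ w∈
    ... | |w|≡q , w≡e = ∈-identityWords⁺ (rotate w) (trans (length-rotate w) |w|≡q) (evaluate-rotate w w≡e)

    identityWords-periodic : Periodic identityWords
    identityWords-periodic {w} w∈ =
      subst (λ k → (rotate ^ k) w ≡ w) (proj₁ (∈-identityWords⁻ w∈)) (rotate-^-length-id w)

    constantWords : List Word
    constantWords = filter fixed? identityWords

    trivialWord∈constantWords : replicate q e ∈ constantWords
    trivialWord∈constantWords = ∈-filter⁺ fixed?
      (∈-identityWords⁺ _ (length-replicate q) (trans (evaluate-replicate q e) (pow-e q)))
      (replicate-∷ʳ r e)

    prime∣length-constantWords : q ∣ length constantWords
    prime∣length-constantWords = prime∣length-fixed identityWords-unique identityWords-closed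
      identityWords-periodic prime∣length-identityWords

    2≤length-constantWords : 2 ≤ length constantWords
    2≤length-constantWords = ≤-trans (ℕ.nonTrivial⇒n>1 q {{prime⇒nonTrivial q-prime}})
      (∣⇒≤ {{∈⇒length-nonZero trivialWord∈constantWords}} prime∣length-constantWords)

    constantWord⇒order : ∀ {w} → w ∈ identityWords → rotate w ≡ w → w ≢ replicate q e →
                         ∃ λ x → HasOrder G x q
    constantWord⇒order {[]} w∈ _ _ with () ← proj₁ (∈-identityWords⁻ w∈)
    constantWord⇒order {x ∷ u} w∈ rotate-w≡w w≢trivial =
      x , prime-order q-prime xᵠ≡e (w≢trivial ∘ trans w≡ ∘ cong (replicate q))
      where
      w≡ : x ∷ u ≡ replicate q x
      w≡ = cong (x ∷_) (trans (∷ʳ≡∷⇒replicate x u rotate-w≡w)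
        (cong (λ k → replicate k x) (suc-injective (proj₁ (∈-identityWords⁻ w∈)))))
      xᵠ≡e : pow G x q ≡ e
      xᵠ≡e = trans (sym (evaluate-replicate q x))
        (trans (cong evaluate (sym w≡)) (proj₂ (∈-identityWords⁻ w∈)))

    ∃-element-of-order : ∃ λ x → HasOrder G x q
    ∃-element-of-order with w , w∈ , w≢trivial ← ∃-≢-in-unique (≡-dec Fin._≟_)
                   (filter⁺ fixed? identityWords-unique) 2≤length-constantWords (replicate q e)
      = constantWord⇒order (proj₁ (∈-filter⁻ fixed? {xs = identityWords} w∈))
          (proj₂ (∈-filter⁻ fixed? {xs = identityWords} w∈)) w≢trivial

  cauchy : ∀ {q} → Prime q → q ∣ n → ∃ λ x → HasOrder G x q
  cauchy {zero} 0-prime = ⊥-elim (ℕ.≢-nonZero⁻¹ 0 {{prime⇒nonZero 0-prime}} refl)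
  cauchy {suc r} q-prime q∣n = McKay.∃-element-of-order r q-prime q∣n

Comparable : ℕ → ℕ → Set
Comparable a b = a ∣ b ⊎ b ∣ a

prime⇒≢1 : ∀ {p} → Prime p → p ≢ 1
prime⇒≢1 p-prime = ℕ.nonTrivial⇒≢1 {{prime⇒nonTrivial p-prime}}

∣prime⇒≡ : ∀ {d p} → Prime p → d ∣ p → d ≢ 1 → d ≡ p
∣prime⇒≡ p-prime d∣p d≢1 with prime⇒irreducible p-prime d∣p
... | inj₁ d≡1 = contradiction d≡1 d≢1
... | inj₂ d≡p = d≡p

prime∣prime⇒≡ : ∀ {p q} → Prime p → Prime q → p ∣ q → p ≡ q
prime∣prime⇒≡ p-prime q-prime p∣q = ∣prime⇒≡ q-prime p∣q (prime⇒≢1 p-prime)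

∃-prime∣ : ∀ {t} → 2 ≤ t → ∃ λ p → Prime p × p ∣ t
∃-prime∣ {t@(suc _)} 2≤t with factorise t
... | record { factors = [] ; isFactorisation = t≡1 } = contradiction t≡1 (>⇒≢ 2≤t)
... | record { factors = p ∷ ps ; isFactorisation = t≡Π ; factorsPrime = p-prime ∷ _ } =
  p , p-prime , subst (p ∣_) (sym t≡Π) (∈⇒∣product {ns = p ∷ ps} (here refl))

product-all≡ : ∀ {p xs} → All (_≡ p) xs → product xs ≡ p ℕ.^ length xs
product-all≡ [] = refl
product-all≡ {p} (refl ∷ xs≡p) = cong (p *_) (product-all≡ xs≡p)

two-prime-divisors : ∀ {n} .{{_ : NonZero n}} → ¬ IsPrimePower n →
                     ∃₂ λ p q → Prime p × Prime q × p ≢ q × p ∣ n × q ∣ n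
two-prime-divisors {n} ¬prime-power with factorise n
... | record { factors = [] ; isFactorisation = n≡1 } =
  contradiction (2 , 0 , prime[2] , n≡1) ¬prime-power
... | record { factors = p ∷ ps ; isFactorisation = n≡Π ; factorsPrime = p-prime ∷ ps-prime }
  with All.all? (_≟ p) ps
...   | yes ps≡p = contradiction
  (p , suc (length ps) , p-prime , trans n≡Π (product-all≡ (refl ∷ ps≡p))) ¬prime-power
...   | no ps≢p with q , q∈ps , q≢p ← find (¬All⇒Any¬ (_≟ p) ps ps≢p) =
  p , q , p-prime , All.lookup ps-prime q∈ps , q≢p ∘ sym ,
  subst (p ∣_) (sym n≡Π) (∈⇒∣product {ns = p ∷ ps} (here refl)) ,
  subst (q ∣_) (sym n≡Π) (∈⇒∣product {ns = p ∷ ps} (there q∈ps))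

-- The second prime q only serves to rule out d = p.
prime∣-of-comparable : ∀ {d p q} → Prime p → Prime q → p ≢ q → d ≢ 1 →
                       Comparable p d → Comparable q d → p ∣ d
prime∣-of-comparable _ _ _ _ (inj₁ p∣d) _ = p∣d
prime∣-of-comparable p-prime q-prime p≢q _ (inj₂ d∣p) (inj₁ q∣d) =
  contradiction (sym (prime∣prime⇒≡ q-prime p-prime (∣-trans q∣d d∣p))) p≢q
prime∣-of-comparable p-prime q-prime p≢q d≢1 (inj₂ d∣p) (inj₂ d∣q) =
  contradiction (trans (sym (∣prime⇒≡ p-prime d∣p d≢1)) (∣prime⇒≡ q-prime d∣q d≢1)) p≢q

strict-multiple⇒prime-multiple : ∀ {d D} → 0 < D → d ∣ D → ¬ D ∣ d →
                                 ∃ λ r → Prime r × r * d ∣ D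
strict-multiple⇒prime-multiple () (divides zero refl) _
strict-multiple⇒prime-multiple {d} _ (divides (suc zero) refl) D∤d =
  contradiction (∣-reflexive (+-identityʳ d)) D∤d
strict-multiple⇒prime-multiple {d} _ (divides t@(suc (suc _)) refl) _
  with r , r-prime , divides c t≡cr ← ∃-prime∣ {t} (s≤s (s≤s z≤n)) =
  r , r-prime , divides c (trans (cong (_* d) t≡cr) (*-assoc c r d))

-- With d = f * s, the divisor r * f of r * d is incomparable with d.
incomparable-divisor′ : ∀ {d D r s} .{{_ : NonZero d}} → Prime r → Prime s → r ≢ s →
                        s ∣ d → r * d ∣ D → ∃ λ k → k ∣ D × ¬ Comparable k d
incomparable-divisor′ {r = r} {s} r-prime s-prime r≢s (divides f refl) rd∣D =
  r * f , ∣-trans (*-monoʳ-∣ r (m∣m*n s)) rd∣D , [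
  (λ rf∣fs → r≢s (prime∣prime⇒≡ r-prime s-prime
    (*-cancelʳ-∣ f (subst (r * f ∣_) (*-comm f s) rf∣fs)))) ,
  (λ fs∣rf → r≢s (sym (prime∣prime⇒≡ s-prime r-prime
    (*-cancelʳ-∣ f (subst (_∣ r * f) (*-comm f s) fs∣rf))))) ]′
  where instance _ = m*n≢0⇒m≢0 f

incomparable-divisor : ∀ {d D p q r} .{{_ : NonZero d}} → Prime p → Prime q → p ≢ q →
                       p ∣ d → q ∣ d → Prime r → r * d ∣ D →
                       ∃ λ k → k ∣ D × ¬ Comparable k d
incomparable-divisor {p = p} {r = r} p-prime q-prime p≢q p∣d q∣d r-prime with r ≟ p
... | no r≢p = incomparable-divisor′ r-prime p-prime r≢p p∣d
... | yes refl = incomparable-divisor′ r-prime q-prime p≢q q∣d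

-- Dominant vertices of the order superpower graph

module Dominance {n : ℕ} (G : FinGroup n) where
  open FinGroup G
  open IsGroup isGroup using (identityʳ)
  open GroupTheory G
  open Cauchy G using (cauchy)

  e-dominant : Dominant G e
  e-dominant h _ = e , h , sameOrder-refl e , sameOrder-refl h , inj₂ (inj₁ (0 , refl))

  order-of-divisor : ∀ {g D k} → HasOrder G g D → k ∣ D → ∃ λ x → HasOrder G x k
  order-of-divisor hD (divides a D≡ak) = _ , order-of-power a _ hD D≡ak

  order-of-power-∣ : ∀ {y k d D} → HasOrder G y D → HasOrder G (pow G y k) d → d ∣ D
  order-of-power-∣ {y} {k} {d} {D} hD hd = order-∣ hd (begin
    pow G (pow G y k) D  ≡⟨ pow-* y k D ⟩
    pow G y (D * k)      ≡⟨ cong (pow G y) (*-comm D k) ⟩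
    pow G y (k * D)      ≡⟨ pow-*-e y D k (proj₁ (proj₂ hD)) ⟩
    e                    ∎)
    where open ≡-Reasoning

  exponent-order-dominant : ∀ {m g} → IsExponent G m → HasOrder G g m → Dominant G g
  exponent-order-dominant {m} {g} exp hg h _
    with D , hD ← order-exists exp h
    with divides a m≡aD ← order-∣ hD (proj₁ (proj₂ exp) h)
    = g , pow G g a , sameOrder-refl g , sameOrder hD (order-of-power a D hg m≡aD) ,
      inj₂ (inj₂ (a , refl))

  dominant⇒comparable : ∀ {g d h D} → Dominant G g → HasOrder G g d → HasOrder G h D →
                        Comparable D d
  dominant⇒comparable {g} {d} {h} {D} dom hd hD with h Fin.≟ g
  ... | yes refl = inj₁ (∣-reflexive (order-unique hD hd))
  ... | no h≢g with dom h h≢g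
  ...   | g′ , h′ , g~g′ , h~h′ , related = comparable related
    where
    hg′ : HasOrder G g′ d
    hg′ = Equivalence.to (g~g′ d) hd
    hh′ : HasOrder G h′ D
    hh′ = Equivalence.to (h~h′ D) hD
    comparable : g′ ≡ h′ ⊎ IsPowerOf G g′ h′ ⊎ IsPowerOf G h′ g′ → Comparable D d
    comparable (inj₁ refl) = inj₁ (∣-reflexive (order-unique hh′ hg′))
    comparable (inj₂ (inj₁ (k , refl))) = inj₂ (order-of-power-∣ {k = k} hh′ hg′)
    comparable (inj₂ (inj₂ (k , refl))) = inj₁ (order-of-power-∣ {k = k} hg′ hh′)

  comparable⇒all-orders-∣ : ∀ {m d p q} → IsExponent G m → .{{_ : NonZero d}} →
    Prime p → Prime q → p ≢ q → p ∣ d → q ∣ d →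
    (∀ {h D} → HasOrder G h D → Comparable D d) → ∀ h → pow G h d ≡ e
  comparable⇒all-orders-∣ {d = d} exp p-prime q-prime p≢q p∣d q∣d comparable h
    with D , hD ← order-exists exp h
    with D ∣? d
  ... | yes D∣d = ∣-order hD D∣d
  ... | no D∤d
    with r , r-prime , rd∣D ← strict-multiple⇒prime-multiple (proj₁ hD)
                                ([ flip contradiction D∤d , id ]′ (comparable hD)) D∤d
    with k , k∣D , incomparable ← incomparable-divisor p-prime q-prime p≢q p∣d q∣d r-prime rd∣D
    with x , hx ← order-of-divisor hD k∣D
    = ⊥-elim (incomparable (comparable hx))

  exponent-≤ : ∀ {m d} → IsExponent G m → 0 < d → (∀ h → pow G h d ≡ e) → m ≤ d
  exponent-≤ (_ , _ , minimal) 0<d all-e = ≮⇒≥ λ d<m → minimal _ 0<d d<m all-e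

  dominant⇒exponent-order : ∀ {m g d} → ¬ IsPrimePower n → IsExponent G m →
                            Dominant G g → g ≢ e → HasOrder G g d → d ≡ m
  dominant⇒exponent-order {m} {g} {d} ¬prime-power exp dom g≢e hd@(0<d , gᵈ≡e , _)
    with p , q , p-prime , q-prime , p≢q , p∣n , q∣n ← two-prime-divisors {{nonZeroIndex e}} ¬prime-power
    = ≤-antisym (∣⇒≤ {{ℕ.>-nonZero (proj₁ exp)}} (order-∣ hd (proj₁ (proj₂ exp) g)))
        (exponent-≤ exp 0<d (comparable⇒all-orders-∣ exp {{ℕ.>-nonZero 0<d}}
          p-prime q-prime p≢q p∣d q∣d comparable))
    where
    comparable : ∀ {h D} → HasOrder G h D → Comparable D d
    comparable = dominant⇒comparable dom hd
    d≢1 : d ≢ 1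
    d≢1 refl = g≢e (trans (sym (identityʳ g)) gᵈ≡e)
    p-comparable : Comparable p d
    p-comparable = comparable (proj₂ (cauchy p-prime p∣n))
    q-comparable : Comparable q d
    q-comparable = comparable (proj₂ (cauchy q-prime q∣n))
    p∣d : p ∣ d
    p∣d = prime∣-of-comparable p-prime q-prime p≢q d≢1 p-comparable q-comparable
    q∣d : q ∣ d
    q∣d = prime∣-of-comparable q-prime p-prime (p≢q ∘ sym) d≢1 q-comparable p-comparable

mainTheorem7 : (n : ℕ) (G : FinGroup n) → ¬ IsPrimePower n →
    (m : ℕ) → IsExponent G m →
    (g : Fin n) → Dominant G g ⇔ (g ≡ FinGroup.e G ⊎ HasOrder G g m)
mainTheorem7 n G ¬prime-power m exp g = mk⇔ dominant⇒ ⇒dominant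
  where
  open FinGroup G using (e)
  open Dominance G

  dominant⇒ : Dominant G g → g ≡ e ⊎ HasOrder G g m
  dominant⇒ dom with g Fin.≟ e
  ... | yes g≡e = inj₁ g≡e
  ... | no g≢e with d , hd ← GroupTheory.order-exists G exp g =
    inj₂ (subst (HasOrder G g) (dominant⇒exponent-order ¬prime-power exp dom g≢e hd) hd)

  ⇒dominant : g ≡ e ⊎ HasOrder G g m → Dominant G g
  ⇒dominant (inj₁ refl) = e-dominant
  ⇒dominant (inj₂ hg) = exponent-order-dominant exp hg
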